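{- Suppose $Q$ is a weakly consistent dimer model that has a perfect matching $\mathcal M$. Let $p$ and $q$ be paths of $Q$ with the same start vertex, the same end vertex, and the same homotopy class. Then $[p]=[q]$ in $A_Q$ if and only if $\mathcal M(p)=\mathcal M(q)$.
   Context: A dimer model is a quiver with faces $Q=(Q_0,Q_1,Q_2)$, $Q_2=Q_2^{cc}\sqcup Q_2^{cl}$ a set of cycles (faces), such that every arrow lies in one face (boundary) or two faces (internal), each internal arrow lies in one face of $Q_2^{cc}$ and one of $Q_2^{cl}$, incidence graphs at vertices are connected, and vertices have finite degree; it embeds in a surface $S(Q)$ glued from polygons. For internal $\alpha$, $R_\alpha^{cc},R_\alpha^{cl}$ are the paths from $h(\alpha)$ to $t(\alpha)$ around the two faces containing $\alpha$; $A_Q=\mathbb CQ/\langle R_\alpha^{cc}-R_\alpha^{cl}\rangle$ and $[p]$ is the class of $p$. $Q$ is weakly consistent if $S(Q)$ is not a sphere and for all vertices $v_1,v_2$ and homotopy classes $C$ of paths from $v_1$ to $v_2$ there is a minimal path $r\in C$ (no face-path, i.e. cycle once around a face, can be factored out of its class), unique up to equivalence, such that every path in $C$ is equivalent to $r$ composed with a unique number $m\ge0$ of face-paths. A perfect matching $\mathcal M$ is a set of arrows containing exactly one arrow of each face; $\mathcal M(p)$ is the number of arrows of $p$ lying in $\mathcal M$, counted with multiplicity. -}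

module Defs where

open import Data.Nat using (ℕ; zero; suc; _≤_)
open import Data.Bool using (Bool; true; false)
open import Data.Maybe using (Maybe; just; nothing)
open import Data.List using (List)
open import Data.List.Membership.Propositional using (_∈_)
open import Data.Sum using (_⊎_; inj₁; inj₂)
open import Data.Product using (Σ; ∃; _×_; _,_; proj₁; proj₂)
open import Relation.Nullary using (¬_)
open import Relation.Binary.PropositionalEquality using (_≡_)
open import Relation.Binary.Construct.Closure.Equivalence using (EqClosure)

record Quiver : Set₁ where
  field
    Q₀ : Set
    Q₁ : Set
    t  : Q₁ → Q₀
    h  : Q₁ → Q₀

module _ (Q : Quiver) where
  open Quiver Q

  -- Paths, written left to right: the first arrow is traversed first.
  infixr 5 _∷_
  data Path : Q₀ → Q₀ → Set where
    []  : ∀ {v} → Path v v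
    _∷_ : ∀ {w} (a : Q₁) → Path (h a) w → Path (t a) w

  data Walk : Q₀ → Q₀ → Set where
    []   : ∀ {v} → Walk v v
    fwd  : ∀ {w} (a : Q₁) → Walk (h a) w → Walk (t a) w
    bwd  : ∀ {w} (a : Q₁) → Walk (t a) w → Walk (h a) w

module _ {Q : Quiver} where
  open Quiver Q

  infixr 5 _++_ _++ʷ_
  _++_ : ∀ {x y z} → Path Q x y → Path Q y z → Path Q x z
  [] ++ q = q
  (a ∷ p) ++ q = a ∷ (p ++ q)

  _++ʷ_ : ∀ {x y z} → Walk Q x y → Walk Q y z → Walk Q x z
  [] ++ʷ q = q
  fwd a p ++ʷ q = fwd a (p ++ʷ q)
  bwd a p ++ʷ q = bwd a (p ++ʷ q)

  toWalk : ∀ {x y} → Path Q x y → Walk Q x y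
  toWalk [] = []
  toWalk (a ∷ p) = fwd a (toWalk p)

  length : ∀ {x y} → Path Q x y → ℕ
  length [] = 0
  length (a ∷ p) = suc (length p)

  arrowAt : ∀ {x y} → Path Q x y → ℕ → Maybe Q₁
  arrowAt [] k = nothing
  arrowAt (a ∷ p) zero = just a
  arrowAt (a ∷ p) (suc k) = arrowAt p k

-- Quivers with faces.  A face is a cycle in Q: a nonempty closed path
-- (considered up to rotation; it is stored with a chosen base vertex).
-- Q₂ = Q₂^cc ⊔ Q₂^cl.

record Face (Q : Quiver) : Set where
  field
    base     : Quiver.Q₀ Q
    cyc      : Path Q base base
    nonempty : 1 ≤ length cyc

record QuiverWithFaces : Set₁ where
  field
    quiver : Quiver
    Fcc    : Set
    Fcl    : Set
    faceCC : Fcc → Face quiver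
    faceCL : Fcl → Face quiver
  open Quiver quiver public

  F : Set
  F = Fcc ⊎ Fcl

  face : F → Face quiver
  face (inj₁ f) = faceCC f
  face (inj₂ f) = faceCL f

module _ (Q : QuiverWithFaces) where
  open QuiverWithFaces Q
  open Face

  P : Q₀ → Q₀ → Set
  P = Path quiver

  IncidenceIn : {X : Set} → (X → Face quiver) → Q₁ → Set
  IncidenceIn {X} fc a = Σ X λ f → Σ ℕ λ k → arrowAt (cyc (fc f)) k ≡ just a

  ExactlyOneIn : {X : Set} → (X → Face quiver) → Q₁ → Set
  ExactlyOneIn fc a = Σ (IncidenceIn fc a) λ i → ∀ (j : IncidenceIn fc a) →
    (proj₁ i ≡ proj₁ j) × (proj₁ (proj₂ i) ≡ proj₁ (proj₂ j))

  Internal : Q₁ → Set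
  Internal a = ExactlyOneIn faceCC a × ExactlyOneIn faceCL a

  Boundary : Q₁ → Set
  Boundary a = ExactlyOneIn face a

  -- Incidence graph at a vertex v: its vertices are the arrow-ends at v
  -- (a head of an arrow ending at v, or a tail of an arrow starting at v);
  -- an edge joins (head of a) and (tail of b) whenever a is immediately
  -- followed by b in some face (cyclically).

  End : Q₀ → Set
  End v = (Σ Q₁ λ a → h a ≡ v) ⊎ (Σ Q₁ λ b → t b ≡ v)

  Consecutive : Q₁ → Q₁ → Set
  Consecutive a b = Σ F λ f → Σ ℕ λ k →
    (arrowAt (cyc (face f) ++ cyc (face f)) k ≡ just a) ×
    (arrowAt (cyc (face f) ++ cyc (face f)) (suc k) ≡ just b)

  data IncEdge (v : Q₀) : End v → End v → Set where
    edge : ∀ a b (ha : h a ≡ v) (tb : t b ≡ v) → Consecutive a b →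
           IncEdge v (inj₁ (a , ha)) (inj₂ (b , tb))

  IncidenceGraphConnected : Q₀ → Set
  IncidenceGraphConnected v = ∀ (e e' : End v) → EqClosure (IncEdge v) e e'

  FiniteDegree : Q₀ → Set
  FiniteDegree v = Σ (List Q₁) λ as → ∀ a → (h a ≡ v ⊎ t a ≡ v) → a ∈ as

  IsDimerModel : Set
  IsDimerModel =
    (∀ a → Internal a ⊎ Boundary a) ×
    (∀ v → IncidenceGraphConnected v) ×
    (∀ v → FiniteDegree v)

  -- Face-paths: a path going once around a face, starting at any of its
  -- vertices (a rotation of the face cycle).

  FacePath : ∀ {x} → P x x → Set
  FacePath {x} c = Σ F λ f → Σ (P (base (face f)) x) λ u → Σ (P x (base (face f))) λ w →
    (cyc (face f) ≡ u ++ w) × (c ≡ w ++ u)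

  -- The relations of A_Q and the class [p]:
  -- R^cc_α (resp. R^cl_α) is the path from h α to t α around the cc (cl)
  -- face containing α.

  data RelPair (α : Q₁) : P (h α) (t α) → P (h α) (t α) → Set where
    rel : (f : Fcc) (g : Fcl)
          (u : P (base (faceCC f)) (t α)) (w : P (h α) (base (faceCC f)))
          (u' : P (base (faceCL g)) (t α)) (w' : P (h α) (base (faceCL g))) →
          cyc (faceCC f) ≡ u ++ (α ∷ w) →
          cyc (faceCL g) ≡ u' ++ (α ∷ w') →
          RelPair α (w ++ u) (w' ++ u')

  data RelStep {x y : Q₀} : P x y → P x y → Set where
    step : ∀ α (u : P x (h α)) (r r' : P (h α) (t α)) (w : P (t α) y) →
           RelPair α r r' → RelStep (u ++ (r ++ w)) (u ++ (r' ++ w))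

  -- [p] = [q] in A_Q  (equality of classes of paths in CQ/⟨R^cc_α - R^cl_α⟩)
  _≈_ : ∀ {x y} → P x y → P x y → Set
  _≈_ = EqClosure RelStep

  -- Homotopy of paths in the surface S(Q) (the 2-complex with vertices
  -- Q₀, edges Q₁ and 2-cells Q₂), with fixed endpoints: the edge-path
  -- groupoid, generated by cancelling backtracks and face boundaries.

  data HStep {x y : Q₀} : Walk quiver x y → Walk quiver x y → Set where
    fb : ∀ a (u : Walk quiver x (t a)) (w : Walk quiver (t a) y) →
         HStep (u ++ʷ fwd a (bwd a w)) (u ++ʷ w)
    bf : ∀ a (u : Walk quiver x (h a)) (w : Walk quiver (h a) y) →
         HStep (u ++ʷ bwd a (fwd a w)) (u ++ʷ w)
    fc : ∀ {z} (u : Walk quiver x z) (c : P z z) (w : Walk quiver z y) →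
         FacePath c → HStep (u ++ʷ (toWalk c ++ʷ w)) (u ++ʷ w)

  HomotopicW : ∀ {x y} → Walk quiver x y → Walk quiver x y → Set
  HomotopicW = EqClosure HStep

  Homotopic : ∀ {x y} → P x y → P x y → Set
  Homotopic p q = HomotopicW (toWalk p) (toWalk q)

  -- S(Q) is a sphere: compact (finitely many cells), without boundary,
  -- nonempty, connected and simply connected.

  Finite : Set → Set
  Finite A = Σ (List A) λ xs → ∀ x → x ∈ xs

  IsSphere : Set
  IsSphere =
    Finite Q₀ × Finite Q₁ × Finite F ×
    (∀ a → Internal a) ×
    Q₀ ×
    (∀ x y → Walk quiver x y) ×
    (∀ x (c : Walk quiver x x) → HomotopicW c [])

  Minimal : ∀ {x y} → P x y → Set
  Minimal {x} {y} r = ¬ (Σ Q₀ λ z → Σ (P x z) λ u → Σ (P z z) λ c → Σ (P z y) λ w →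
    FacePath c × (r ≈ (u ++ (c ++ w))))

  data FacePow (y : Q₀) : ℕ → P y y → Set where
    none : FacePow y zero []
    more : ∀ {m c d} → FacePath c → FacePow y m d → FacePow y (suc m) (c ++ d)

  WeaklyConsistent : Set
  WeaklyConsistent =
    ¬ IsSphere ×
    (∀ x y (p : P x y) →            -- the homotopy class C of p
      Σ (P x y) λ r →
        Homotopic r p × Minimal r ×
        (∀ r' → Homotopic r' p → Minimal r' → r' ≈ r) ×
        (∀ s → Homotopic s p →
          Σ ℕ λ m →
            (Σ (P y y) λ d → FacePow y m d × (s ≈ (r ++ d))) ×
            (∀ m' d' → FacePow y m' d' → s ≈ (r ++ d') → m' ≡ m)))

  -- Perfect matchings (a set of arrows, given by its indicator function)

  count : (Q₁ → Bool) → ∀ {x y} → P x y → ℕ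
  count M [] = 0
  count M (a ∷ p) with M a
  ... | true  = suc (count M p)
  ... | false = count M p

  IsPerfectMatching : (Q₁ → Bool) → Set
  IsPerfectMatching M = ∀ (f : F) → count M (cyc (face f)) ≡ 1

{-# OPTIONS --safe #-}
module Submission where

-- ℳ is additive on paths, and R^cc_α and R^cl_α both close α up to a face, which ℳ meets exactly
-- once; hence ℳ(R^cc_α) = ℳ(R^cl_α) and ℳ is constant on classes.  Conversely, weak consistency
-- gives p ≈ r d and q ≈ r d′ with d, d′ composites of m and m′ face-paths; ℳ gives m = m′, so it
-- suffices that all face-paths at a vertex y are equal in A_Q.  A face-path leaving y through the
-- arrow b is b R with R a path around a face containing b, and two such R are equal (same face)
-- or form a relation R^cc_b − R^cl_b; likewise for face-paths entering y through a given arrow.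
-- If a is followed by b in a face, the face-path entering y through a leaves it through b, so
-- connectedness of the incidence graph at y links any two face-paths at y.

open import Data.Bool using (Bool; true; false)
open import Data.Nat using (ℕ; zero; suc; _+_; _≤_)
open import Data.Nat.Properties using (suc-injective; +-comm; +-cancelˡ-≡)
open import Data.List as L using (List; []; _∷_)
open import Data.List.Properties using (∷-injective; ∷-injectiveˡ; ∷-injectiveʳ)
open import Data.Maybe using (just)
open import Data.Product using (Σ; ∃; ∃₂; _×_; _,_; proj₁; proj₂)
open import Data.Sum using (_⊎_; inj₁; inj₂)
open import Function.Bundles using (_⇔_; mk⇔)
open import Relation.Binary.PropositionalEquality
import Relation.Binary.Construct.Closure.Equivalence as EC
open import Relation.Binary.Construct.Closure.ReflexiveTransitive using (ε; _◅_; _◅◅_)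
open import Relation.Binary.Construct.Closure.Symmetric using (fwd; bwd)

module _ {A : Set} where
  open L using (_++_; length)

  ++-injective-length : ∀ (xs ys : List A) {zs ws} → length xs ≡ length ys →
                        xs ++ zs ≡ ys ++ ws → xs ≡ ys × zs ≡ ws
  ++-injective-length []       []       _   eq = refl , eq
  ++-injective-length (x ∷ xs) (y ∷ ys) len eq
    with refl , eq′ ← ∷-injective eq
    with refl , zs≡ws ← ++-injective-length xs ys (suc-injective len) eq′ = refl , zs≡ws

  levi : ∀ (xs ys us vs : List A) → xs ++ ys ≡ us ++ vs →
         (∃ λ m → us ≡ xs ++ m × ys ≡ m ++ vs) ⊎ (∃ λ m → xs ≡ us ++ m × vs ≡ m ++ ys)
  levi []       ys us       vs eq = inj₁ (us , refl , eq)
  levi (x ∷ xs) ys []       vs eq = inj₂ (x ∷ xs , refl , sym eq)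
  levi (x ∷ xs) ys (u ∷ us) vs eq with refl , eq′ ← ∷-injective eq with levi xs ys us vs eq′
  ... | inj₁ (m , us≡ , ys≡) = inj₁ (m , cong (x ∷_) us≡ , ys≡)
  ... | inj₂ (m , xs≡ , vs≡) = inj₂ (m , cong (x ∷_) xs≡ , vs≡)

  cyclic-successor : ∀ (Γ X Y : List A) {a b} → Γ ++ Γ ≡ X ++ a ∷ b ∷ Y →
                     ∃₂ λ U W → Γ ≡ U ++ a ∷ W × ∃ λ B → W ++ U ++ a ∷ [] ≡ b ∷ B
  cyclic-successor Γ X Y eq with levi Γ Γ X (_ ∷ _ ∷ Y) eq
  ... | inj₁ (m , _ , Γ≡)                = m , _ , Γ≡ , _ , refl
  ... | inj₂ ([] , _ , refl)             = [] , _ , refl , _ , refl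
  ... | inj₂ (_ ∷ [] , Γ≡ , refl)        = X , [] , Γ≡ , Y , sym Γ≡
  ... | inj₂ (_ ∷ _ ∷ m , Γ≡ , refl)     = X , _ , Γ≡ , _ , refl

open import Defs

module _ {G : Quiver} where
  open Quiver G

  ++-assoc : ∀ {w x y z} (p : Path G w x) (q : Path G x y) (r : Path G y z) →
             (p ++ q) ++ r ≡ p ++ (q ++ r)
  ++-assoc []      q r = refl
  ++-assoc (a ∷ p) q r = cong (a ∷_) (++-assoc p q r)

  ++-identityʳ : ∀ {x y} (p : Path G x y) → p ++ [] ≡ p
  ++-identityʳ []      = refl
  ++-identityʳ (a ∷ p) = cong (a ∷_) (++-identityʳ p)

  toList : ∀ {x y} → Path G x y → List Q₁
  toList []      = []
  toList (a ∷ p) = a ∷ toList p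

  toList-++ : ∀ {x y z} (p : Path G x y) (q : Path G y z) → toList (p ++ q) ≡ toList p L.++ toList q
  toList-++ []      q = refl
  toList-++ (a ∷ p) q = cong (a ∷_) (toList-++ p q)

  toList-++-++ : ∀ {w x y z} (p : Path G w x) (q : Path G x y) (r : Path G y z) →
                 toList (p ++ q ++ r) ≡ toList p L.++ toList q L.++ toList r
  toList-++-++ p q r = trans (toList-++ p (q ++ r)) (cong (toList p L.++_) (toList-++ q r))

  length-toList : ∀ {x y} (p : Path G x y) → length p ≡ L.length (toList p)
  length-toList []      = refl
  length-toList (a ∷ p) = cong suc (length-toList p)

  toList-injectiveΣ : ∀ {x x′ y} (p : Path G x y) (q : Path G x′ y) → toList p ≡ toList q →
                      _≡_ {A = Σ Q₀ λ v → Path G v y} (x , p) (x′ , q)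
  toList-injectiveΣ []      []      _  = refl
  toList-injectiveΣ (a ∷ p) (b ∷ q) eq
    with refl , eq′ ← ∷-injective eq with refl ← toList-injectiveΣ p q eq′ = refl

  toList-injective : ∀ {x y} {p q : Path G x y} → toList p ≡ toList q → p ≡ q
  toList-injective {p = p} {q} eq with refl ← toList-injectiveΣ p q eq = refl

  record Cut {x y} (p : Path G x y) (a : Q₁) : Set where
    constructor cut
    field
      before : Path G x (t a)
      after  : Path G (h a) y
      splits : p ≡ before ++ a ∷ after

  open Cut public

  return : ∀ {z a} {γ : Path G z z} → Cut γ a → Path G (h a) (t a)
  return κ = after κ ++ before κ

  toList-cut : ∀ {x y a} (p : Path G x y) {U W} → toList p ≡ U L.++ a ∷ W →
               Σ (Cut p a) λ κ → toList (before κ) ≡ U × toList (after κ) ≡ W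
  toList-cut []      {[]}    ()
  toList-cut []      {_ ∷ _} ()
  toList-cut (b ∷ p) {[]}    eq with refl , p≡ ← ∷-injective eq = cut [] p refl , refl , p≡
  toList-cut (b ∷ p) {_ ∷ _} eq
    with refl , eq′ ← ∷-injective eq with κ , U≡ , W≡ ← toList-cut p eq′ =
    cut (b ∷ before κ) (after κ) (cong (b ∷_) (splits κ)) , cong (b ∷_) U≡ , W≡

  arrowAt-++-∷ : ∀ {x y a} (u : Path G x (t a)) (w : Path G (h a) y) →
                 arrowAt (u ++ a ∷ w) (length u) ≡ just a
  arrowAt-++-∷ []      w = refl
  arrowAt-++-∷ (b ∷ u) w = arrowAt-++-∷ u w

  arrowAt-cut : ∀ {x y a} {p : Path G x y} (κ : Cut p a) → arrowAt p (length (before κ)) ≡ just a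
  arrowAt-cut (cut u w refl) = arrowAt-++-∷ u w

  toList-splits : ∀ {x y a} {p : Path G x y} (κ : Cut p a) →
                  toList p ≡ toList (before κ) L.++ a ∷ toList (after κ)
  toList-splits {a = a} (cut u w refl) = toList-++ u (a ∷ w)

  cut-unique : ∀ {x y a} {p : Path G x y} (κ κ′ : Cut p a) → length (before κ) ≡ length (before κ′) →
               before κ ≡ before κ′ × after κ ≡ after κ′
  cut-unique κ κ′ len
    with before≡ , after≡ ← ++-injective-length (toList (before κ)) (toList (before κ′))
           (trans (sym (length-toList (before κ))) (trans len (length-toList (before κ′))))
           (trans (sym (toList-splits κ)) (toList-splits κ′))
    = toList-injective before≡ , toList-injective (∷-injectiveʳ after≡)

  first-arrow : ∀ {x y b} (p : Path G x y) → arrowAt p 0 ≡ just b → ∃ λ B → toList p ≡ b ∷ B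
  first-arrow (b ∷ p) refl = toList p , refl

  adjacent-arrows : ∀ {x y a b} (p : Path G x y) k →
                    arrowAt p k ≡ just a → arrowAt p (suc k) ≡ just b →
                    ∃₂ λ X Y → toList p ≡ X L.++ a ∷ b ∷ Y
  adjacent-arrows (c ∷ p) zero refl next
    with Y , p≡ ← first-arrow p next = [] , Y , cong (c ∷_) p≡
  adjacent-arrows (c ∷ p) (suc k) at next
    with X , Y , p≡ ← adjacent-arrows p k at next = c ∷ X , Y , cong (c ∷_) p≡

  rotation-as-cut : ∀ {z y} {γ : Path G z z} (u : Path G z y) (w : Path G y z) →
                    γ ≡ u ++ w → 1 ≤ length γ →
                    Σ Q₁ λ b → t b ≡ y ×
                      Σ (Cut γ b) λ κ → toList (w ++ u) ≡ toList (b ∷ return κ)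
  rotation-as-cut u       (b ∷ w) γ≡   _  = b , refl , cut u w γ≡ , refl
  rotation-as-cut (b ∷ u) []      γ≡   _  =
    b , refl , cut [] u (trans γ≡ (++-identityʳ (b ∷ u))) ,
    cong (λ r → b ∷ toList r) (sym (++-identityʳ u))
  rotation-as-cut []      []      refl ()

  successor-rotation : ∀ {z a b} {γ : Path G z z} k → 1 ≤ length γ →
                       arrowAt (γ ++ γ) k ≡ just a → arrowAt (γ ++ γ) (suc k) ≡ just b →
                       Σ (Cut γ a) λ κ → Σ (Cut γ b) λ κ′ →
                         toList (return κ ++ a ∷ []) ≡ toList (b ∷ return κ′)
  successor-rotation {a = a} {γ = γ} k nonempty at-k at-suc-k
    with X , Y , γγ≡ ← adjacent-arrows (γ ++ γ) k at-k at-suc-k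
    with U , W , γ≡ , B , starts-b ← cyclic-successor (toList γ) X Y (trans (sym (toList-++ γ γ)) γγ≡)
    with cut u w γ≡uaw , refl , refl ← toList-cut γ γ≡
    with b′ , _ , κ′ , loop≡ ← rotation-as-cut (u ++ a ∷ []) w
                                  (trans γ≡uaw (sym (++-assoc u (a ∷ []) w))) nonempty
    with refl ← ∷-injectiveˡ (trans (sym loop≡) (trans (toList-++-++ w u (a ∷ [])) starts-b))
    = cut u w γ≡uaw , κ′ , trans (cong toList (++-assoc w u (a ∷ []))) loop≡

module _ (Q : QuiverWithFaces) where
  open QuiverWithFaces Q
  open Face

  infix 4 _≈ᴬ_
  _≈ᴬ_ : ∀ {x y} → P Q x y → P Q x y → Set
  _≈ᴬ_ = _≈_ Q

  relStep-++ˡ : ∀ {x y z} (s : P Q x y) {p q : P Q y z} →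
                RelStep Q p q → RelStep Q (s ++ p) (s ++ q)
  relStep-++ˡ s (step α u r r′ w rp) =
    subst₂ (RelStep Q) (++-assoc s u (r ++ w)) (++-assoc s u (r′ ++ w)) (step α (s ++ u) r r′ w rp)

  relStep-++ʳ : ∀ {x y z} (s : P Q y z) {p q : P Q x y} →
                RelStep Q p q → RelStep Q (p ++ s) (q ++ s)
  relStep-++ʳ s (step α u r r′ w rp) =
    subst₂ (RelStep Q) (reassoc r) (reassoc r′) (step α u r r′ (w ++ s) rp)
    where
    reassoc : ∀ r → u ++ (r ++ (w ++ s)) ≡ (u ++ (r ++ w)) ++ s
    reassoc r = sym (trans (++-assoc u (r ++ w) s) (cong (u ++_) (++-assoc r w s)))

  ++-congˡ : ∀ {x y z} (s : P Q x y) {p q : P Q y z} → p ≈ᴬ q → s ++ p ≈ᴬ s ++ q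
  ++-congˡ s = EC.gmap (s ++_) (relStep-++ˡ s)

  ++-congʳ : ∀ {x y z} (s : P Q y z) {p q : P Q x y} → p ≈ᴬ q → p ++ s ≈ᴬ q ++ s
  ++-congʳ s = EC.gmap (_++ s) (relStep-++ʳ s)

  ++-cong : ∀ {x y z} {p q : P Q x y} {p′ q′ : P Q y z} →
            p ≈ᴬ q → p′ ≈ᴬ q′ → p ++ p′ ≈ᴬ q ++ q′
  ++-cong {q = q} {p′} p≈q p′≈q′ = ++-congʳ p′ p≈q ◅◅ ++-congˡ q p′≈q′

  ≡⇒≈ᴬ : ∀ {x y} {p q : P Q x y} → p ≡ q → p ≈ᴬ q
  ≡⇒≈ᴬ refl = ε

  relPair⇒≈ᴬ : ∀ {α r r′} → RelPair Q α r r′ → r ≈ᴬ r′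
  relPair⇒≈ᴬ {α} {r} {r′} rp =
    EC.return (subst₂ (RelStep Q) (++-identityʳ r) (++-identityʳ r′) (step α [] r r′ [] rp))

  module _ (M : Q₁ → Bool) where
    private
      ℳ : ∀ {x y} → P Q x y → ℕ
      ℳ = count Q M

    count-++ : ∀ {x y z} (p : P Q x y) (q : P Q y z) → ℳ (p ++ q) ≡ ℳ p + ℳ q
    count-++ []      q = refl
    count-++ (a ∷ p) q with M a
    ... | true  = cong suc (count-++ p q)
    ... | false = count-++ p q

    count-rotate : ∀ {x y} (u : P Q x y) (w : P Q y x) → ℳ (w ++ u) ≡ ℳ (u ++ w)
    count-rotate u w = trans (count-++ w u) (trans (+-comm (ℳ w) (ℳ u)) (sym (count-++ u w)))

    count-return : ∀ {z α} {γ : P Q z z} (κ : Cut γ α) → ℳ (α ∷ []) + ℳ (return κ) ≡ ℳ γ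
    count-return {α = α} (cut u w refl) =
      trans (sym (count-++ (α ∷ []) (w ++ u))) (count-rotate u (α ∷ w))

    module _ (perfect : IsPerfectMatching Q M) where

      count-relPair : ∀ {α r r′} → RelPair Q α r r′ → ℳ r ≡ ℳ r′
      count-relPair {α} (rel f g u w u′ w′ eq eq′) = +-cancelˡ-≡ (ℳ (α ∷ [])) _ _ (begin
        ℳ (α ∷ []) + ℳ (w ++ u)     ≡⟨ count-return (cut u w eq) ⟩
        ℳ (cyc (faceCC f))           ≡⟨ perfect (inj₁ f) ⟩
        1                            ≡⟨ perfect (inj₂ g) ⟨
        ℳ (cyc (faceCL g))           ≡⟨ count-return (cut u′ w′ eq′) ⟨
        ℳ (α ∷ []) + ℳ (w′ ++ u′)   ∎)
        where open ≡-Reasoning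

      count-relStep : ∀ {x y} {p q : P Q x y} → RelStep Q p q → ℳ p ≡ ℳ q
      count-relStep (step α u r r′ w rp) = begin
        ℳ (u ++ (r ++ w))       ≡⟨ count-++ u (r ++ w) ⟩
        ℳ u + ℳ (r ++ w)        ≡⟨ cong (ℳ u +_) (count-++ r w) ⟩
        ℳ u + (ℳ r + ℳ w)       ≡⟨ cong (λ n → ℳ u + (n + ℳ w)) (count-relPair rp) ⟩
        ℳ u + (ℳ r′ + ℳ w)      ≡⟨ cong (ℳ u +_) (count-++ r′ w) ⟨
        ℳ u + ℳ (r′ ++ w)       ≡⟨ count-++ u (r′ ++ w) ⟨
        ℳ (u ++ (r′ ++ w))      ∎
        where open ≡-Reasoning

      count-≈ᴬ : ∀ {x y} {p q : P Q x y} → p ≈ᴬ q → ℳ p ≡ ℳ q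
      count-≈ᴬ = EC.gfold isEquivalence ℳ count-relStep

      count-facePath : ∀ {y} {c : P Q y y} → FacePath Q c → ℳ c ≡ 1
      count-facePath (f , u , w , γ≡ , refl) =
        trans (count-rotate u w) (trans (cong ℳ (sym γ≡)) (perfect f))

      count-facePow : ∀ {y m d} → FacePow Q y m d → ℳ d ≡ m
      count-facePow none = refl
      count-facePow (more {c = c} {d} c-face d-pow) =
        trans (count-++ c d) (cong₂ _+_ (count-facePath c-face) (count-facePow d-pow))

      count-factor : ∀ {x y m} {s r : P Q x y} {d : P Q y y} → s ≈ᴬ r ++ d → FacePow Q y m d →
                     ℳ s ≡ ℳ r + m
      count-factor {r = r} {d} s≈rd d-pow =
        trans (count-≈ᴬ s≈rd) (trans (count-++ r d) (cong (ℳ r +_) (count-facePow d-pow)))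

  -- The rotation of the face lies over h a (resp. t b), which equals y only propositionally,
  -- so c is compared with it as a list of arrows.
  FaceLoop : ∀ {y} → End Q y → P Q y y → Set
  FaceLoop (inj₁ (a , _)) c =
    Σ F λ f → Σ (Cut (cyc (face f)) a) λ κ → toList c ≡ toList (return κ ++ a ∷ [])
  FaceLoop (inj₂ (b , _)) c =
    Σ F λ f → Σ (Cut (cyc (face f)) b) λ κ → toList c ≡ toList (b ∷ return κ)

  facePath-faceLoop : ∀ {y} {c : P Q y y} → FacePath Q c → Σ (End Q y) λ e → FaceLoop e c
  facePath-faceLoop (f , u , w , γ≡ , refl)
    with b , tb , κ , c≡ ← rotation-as-cut u w γ≡ (nonempty (face f)) = inj₂ (b , tb) , f , κ , c≡

  incEdge-faceLoops : ∀ {y} {e e′ : End Q y} → IncEdge Q y e e′ →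
                      ∃ λ c → FaceLoop e c × FaceLoop e′ c
  incEdge-faceLoops (edge a b refl _ (f , k , at-k , at-suc-k))
    with κ , κ′ , loop≡ ← successor-rotation k (nonempty (face f)) at-k at-suc-k =
    return κ ++ a ∷ [] , (f , κ , refl) , (f , κ′ , loop≡)

  same-incidence : ∀ {X} (faces : X → Face quiver) {a} → ExactlyOneIn Q faces a →
                   ∀ {g g′} (κ : Cut (cyc (faces g)) a) (κ′ : Cut (cyc (faces g′)) a) →
                   g ≡ g′ × length (before κ) ≡ length (before κ′)
  same-incidence _ (_ , unique) {g} {g′} κ κ′
    with f≡ , k≡ ← unique (g , length (before κ) , arrowAt-cut κ)
    with f≡′ , k≡′ ← unique (g′ , length (before κ′) , arrowAt-cut κ′) =
    trans (sym f≡) f≡′ , trans (sym k≡) k≡′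

  unique-incidence-return : ∀ {X} (faces : X → Face quiver) {a} → ExactlyOneIn Q faces a →
    (g g′ : X) (κ : Cut (cyc (faces g)) a) (κ′ : Cut (cyc (faces g′)) a) → return κ ≡ return κ′
  unique-incidence-return faces one g g′ κ κ′
    with refl , same-position ← same-incidence faces one κ κ′
    with before≡ , after≡ ← cut-unique κ κ′ same-position = cong₂ _++_ after≡ before≡

  module _ (arrows : ∀ a → Internal Q a ⊎ Boundary Q a) where

    cut-returns-≈ᴬ : ∀ {a} (f f′ : F) (κ : Cut (cyc (face f)) a) (κ′ : Cut (cyc (face f′)) a) →
                     return κ ≈ᴬ return κ′
    cut-returns-≈ᴬ {a} f f′ κ κ′ with arrows a
    cut-returns-≈ᴬ f         f′         κ κ′ | inj₂ boundary =
      ≡⇒≈ᴬ (unique-incidence-return face boundary f f′ κ κ′)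
    cut-returns-≈ᴬ (inj₁ g) (inj₁ g′) κ κ′ | inj₁ (cc , _) =
      ≡⇒≈ᴬ (unique-incidence-return faceCC cc g g′ κ κ′)
    cut-returns-≈ᴬ (inj₂ g) (inj₂ g′) κ κ′ | inj₁ (_ , cl) =
      ≡⇒≈ᴬ (unique-incidence-return faceCL cl g g′ κ κ′)
    cut-returns-≈ᴬ (inj₁ g) (inj₂ g′) (cut u w eq) (cut u′ w′ eq′) | inj₁ _ =
      relPair⇒≈ᴬ (rel g g′ u w u′ w′ eq eq′)
    cut-returns-≈ᴬ (inj₂ g) (inj₁ g′) (cut u w eq) (cut u′ w′ eq′) | inj₁ _ =
      EC.symmetric (RelStep Q) (relPair⇒≈ᴬ (rel g′ g u′ w′ u w eq′ eq))

    faceLoop-≈ᴬ : ∀ {y} (e : End Q y) {c c′ : P Q y y} →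
                  FaceLoop e c → FaceLoop e c′ → c ≈ᴬ c′
    faceLoop-≈ᴬ (inj₁ (a , refl)) (f , κ , c≡) (f′ , κ′ , c′≡)
      with refl ← toList-injective c≡ | refl ← toList-injective c′≡ =
      ++-congʳ (a ∷ []) (cut-returns-≈ᴬ f f′ κ κ′)
    faceLoop-≈ᴬ (inj₂ (b , refl)) (f , κ , c≡) (f′ , κ′ , c′≡)
      with refl ← toList-injective c≡ | refl ← toList-injective c′≡ =
      ++-congˡ (b ∷ []) (cut-returns-≈ᴬ f f′ κ κ′)

    faceLoops-connected-≈ᴬ : ∀ {y} {e e′ : End Q y} {c c′ : P Q y y} →
                             EC.EqClosure (IncEdge Q y) e e′ →
                             FaceLoop e c → FaceLoop e′ c′ → c ≈ᴬ c′
    faceLoops-connected-≈ᴬ {e = e} ε c-loop c′-loop = faceLoop-≈ᴬ e c-loop c′-loop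
    faceLoops-connected-≈ᴬ {e = e} (fwd link ◅ path) c-loop c′-loop
      with _ , e-loop , e′-loop ← incEdge-faceLoops link =
      faceLoop-≈ᴬ e c-loop e-loop ◅◅ faceLoops-connected-≈ᴬ path e′-loop c′-loop
    faceLoops-connected-≈ᴬ {e = e} (bwd link ◅ path) c-loop c′-loop
      with _ , e′-loop , e-loop ← incEdge-faceLoops link =
      faceLoop-≈ᴬ e c-loop e-loop ◅◅ faceLoops-connected-≈ᴬ path e′-loop c′-loop

  module _ (dimer : IsDimerModel Q) where

    facePaths-≈ᴬ : ∀ {y} {c c′ : P Q y y} → FacePath Q c → FacePath Q c′ → c ≈ᴬ c′
    facePaths-≈ᴬ {y} c-face c′-face
      with e , c-loop ← facePath-faceLoop c-face | e′ , c′-loop ← facePath-faceLoop c′-face =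
      faceLoops-connected-≈ᴬ (proj₁ dimer) (proj₁ (proj₂ dimer) y e e′) c-loop c′-loop

    facePowers-≈ᴬ : ∀ {y m d d′} → FacePow Q y m d → FacePow Q y m d′ → d ≈ᴬ d′
    facePowers-≈ᴬ none                 none                   = ε
    facePowers-≈ᴬ (more c-face d-pow) (more c′-face d′-pow) =
      ++-cong (facePaths-≈ᴬ c-face c′-face) (facePowers-≈ᴬ d-pow d′-pow)

proposition6p2 : (Q : QuiverWithFaces) → IsDimerModel Q → WeaklyConsistent Q →
    (M : QuiverWithFaces.Q₁ Q → Bool) → IsPerfectMatching Q M →
    ∀ {x y} (p q : P Q x y) → Homotopic Q p q →
    (_≈_ Q p q ⇔ count Q M p ≡ count Q M q)
proposition6p2 Q dimer (_ , consistent) M perfect {x} {y} p q p∼q =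
  mk⇔ (count-≈ᴬ Q M perfect) from-count
  where
  from-count : count Q M p ≡ count Q M q → _≈_ Q p q
  from-count same-count
    with r , _ , _ , _ , factor ← consistent x y p
    with m , (d , d-pow , p≈rd) , _ ← factor p ε
    with n , (e , e-pow , q≈re) , _ ← factor q (EC.symmetric (HStep Q) p∼q)
    with refl ← +-cancelˡ-≡ (count Q M r) m n
                  (trans (sym (count-factor Q M perfect p≈rd d-pow))
                         (trans same-count (count-factor Q M perfect q≈re e-pow)))
    = p≈rd ◅◅ ++-congˡ Q r (facePowers-≈ᴬ Q dimer d-pow e-pow) ◅◅ EC.symmetric (RelStep Q) q≈re
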